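{- Let $n>r>0$ be integers and $b=(b_1,\dots,b_r)\in(\mathbb{N}^*)^r$ with $b_1+\cdots+b_r=n$. Let $c_j=\sum_{k=1}^{j}b_k$ for $j\in[r]$ and $\mathcal{A}_b=\{c_1,\dots,c_r\}$. Let $\mathcal{C}$ be the set of all pairs $(\mathcal{S},\theta)$ where $\mathcal{S}$ is a nonempty subset of $[n]$ and $\theta=(\theta_1,\dots,\theta_n)\in\mathcal{S}^n$ satisfies: $\theta_n=\max\mathcal{S}$, and for every $c_j\in\mathcal{A}_b$, $\theta_{c_j}\ge\theta_k$ for all $k<c_j$ and $\theta_{c_j}<\theta_k$ for all $k>c_j$. Define $wt(\mathcal{S},\theta)=(-1)^{|\mathcal{S}|}$. Then there is an involution $\phi$ on $\mathcal{C}$ (a bijection $\phi:\mathcal{C}\to\mathcal{C}$ with $\phi=\phi^{ -1}$) such that $wt(\mathcal{S},\theta)=-wt(\phi(\mathcal{S},\theta))$ for all $(\mathcal{S},\theta)\in\mathcal{C}$.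
   Context: $\mathbb{N}^*$ denotes the set of positive integers and $[n]=\{1,\dots,n\}$. -}

module Defs where

open import Data.Nat using (ℕ; zero; suc; _+_; _<_)
open import Data.Fin as F using (Fin; toℕ)
open import Data.Fin.Subset using (Subset; _∈_; Nonempty; ∣_∣)
open import Data.Vec using (Vec; lookup)
open import Data.Product using (_×_)
open import Data.Integer as ℤ using (ℤ)
open import Function using (_∘_)

-- prefixSum b m = b_1 + ... + b_m  (b indexed by Fin r, entry k ↦ b_{k+1})
prefixSum : ∀ {r} → (Fin r → ℕ) → ℕ → ℕ
prefixSum {zero}  b m       = 0
prefixSum {suc r} b zero    = 0
prefixSum {suc r} b (suc m) = b F.zero + prefixSum (b ∘ F.suc) m

-- c_j = b_1 + ... + b_j, for j ∈ [r] represented by Fin r (index j ↦ j+1)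
cpos : ∀ {r} → (Fin r → ℕ) → Fin r → ℕ
cpos b j = prefixSum b (suc (toℕ j))

IsMax : ∀ {n} → Subset n → Fin n → Set
IsMax S m = m ∈ S × (∀ x → x ∈ S → x F.≤ m)

-- Elements of [n] are represented by Fin n (value v ↦ v+1);
-- positions 1..n of θ likewise (vector index q ↦ position q+1).
-- (S , θ) ∈ 𝒞
InC : ∀ {n r} → (Fin r → ℕ) → Subset n → Vec (Fin n) n → Set
InC {n} b S θ =
  Nonempty S
  × (∀ q → lookup θ q ∈ S)
  × (∀ q → toℕ q + 1 ≡ n → IsMax S (lookup θ q))
  × (∀ j q → toℕ q + 1 ≡ cpos b j →
       (∀ k → toℕ k < toℕ q → lookup θ k F.≤ lookup θ q)
       × (∀ k → toℕ q < toℕ k → lookup θ q F.< lookup θ k))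
  where open import Relation.Binary.PropositionalEquality using (_≡_)

wt : ∀ {n} → Subset n → ℤ
wt S = ℤ.-1ℤ ℤ.^ ∣ S ∣

-- If some value below max S is missing from θ, toggle the least such value in S; the choice
-- depends on θ alone, so toggling again undoes it. Otherwise S = {θ₁, …, θₙ} = {1, …, θₙ},
-- and we change θₙ, hence |S|, by one. As n > r, some block (c_{j-1}, c_j] has length at
-- least 2; let p = c_j. If another position shares the value θ_p, split it off: raise θ_p
-- and every larger value by one. Otherwise merge θ_p into θ_p − 1: lower θ_p and every
-- larger value by one. Merging keeps the block-end conditions because p − 1 is no block
-- end, so a block end before p carries a value below θ_{p-1} < θ_p. The two operations are
-- mutually inverse and each leaves no missing value.
module Submission where

open import Defs
open import Data.Bool using (Bool; true; false; not)
open import Data.Bool.Properties using (not-involutive)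
open import Data.Fin as F using (Fin; zero; suc; toℕ; fromℕ; fromℕ<)
open import Data.Fin.Properties using (toℕ-injective; toℕ-fromℕ; toℕ-fromℕ<; toℕ≤pred[n]; ≤fromℕ; any?; injective⇒≤)
open import Data.Fin.Subset using (Subset; _∈_; ∣_∣; inside; outside; ⊥)
open import Data.Fin.Subset.Properties using (∣⊥∣≡0; ∉⊥; ⊆-antisym)
open import Data.Integer as ℤ using (ℤ; -_; -1ℤ)
open import Data.Integer.Properties using (-1*i≡-i; neg-involutive)
open import Data.Nat
open import Data.Nat.Properties
open import Data.Product using (Σ; ∃; ∃₂; _×_; _,_; proj₁; proj₂; uncurry)
open import Data.Sum using (inj₁; inj₂)
open import Data.Vec using (Vec; _∷_; lookup; tabulate; updateAt; here; there)
open import Data.Vec.Properties using (updateAt-minimal; updateAt-updateAt; updateAt-cong; updateAt-id; lookup∘tabulate; tabulate-cong; tabulate∘lookup)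
open import Function using (_∘_; id)
open import Relation.Nullary using (¬_; Dec; yes; no; does; ¬?; _×-dec_; contradiction)
open import Relation.Binary.Definitions using (tri<; tri≈; tri>)
open import Relation.Binary.PropositionalEquality

neg-swap : {a c : ℤ} → a ≡ - c → c ≡ - a
neg-swap {a} {c} a≡-c = trans (sym (neg-involutive c)) (cong -_ (sym a≡-c))

toggle : ∀ {n} → Subset n → Fin n → Subset n
toggle S v = updateAt S v not

toggle-involutive : ∀ {n} (S : Subset n) (v : Fin n) → toggle (toggle S v) v ≡ S
toggle-involutive S v = begin
  updateAt (updateAt S v not) v not ≡⟨ updateAt-updateAt v S ⟩
  updateAt S v (not ∘ not)          ≡⟨ updateAt-cong v not-involutive S ⟩
  updateAt S v id                   ≡⟨ updateAt-id v S ⟩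
  S                                 ∎
  where open ≡-Reasoning

∈-toggle⁺ : ∀ {n} {S : Subset n} {x v} → x ≢ v → x ∈ S → x ∈ toggle S v
∈-toggle⁺ {S = S} {x} {v} x≢v = updateAt-minimal x v S x≢v

∈-toggle⁻ : ∀ {n} {S : Subset n} {x v} → x ≢ v → x ∈ toggle S v → x ∈ S
∈-toggle⁻ {S = S} {x} {v} x≢v x∈ = subst (x ∈_) (toggle-involutive S v) (∈-toggle⁺ x≢v x∈)

upTo : ∀ {n} → Fin n → Subset n
upTo zero    = inside ∷ ⊥
upTo (suc m) = inside ∷ upTo m

∈-upTo⁺ : ∀ {n} {x m : Fin n} → x F.≤ m → x ∈ upTo m
∈-upTo⁺ {x = zero}  {zero}  _       = here
∈-upTo⁺ {x = zero}  {suc m} _       = here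
∈-upTo⁺ {x = suc x} {suc m} (s≤s h) = there (∈-upTo⁺ h)

∈-upTo⁻ : ∀ {n} {x m : Fin n} → x ∈ upTo m → x F.≤ m
∈-upTo⁻ {x = zero}          _           = z≤n
∈-upTo⁻ {x = suc x} {zero}  (there x∈⊥) = contradiction x∈⊥ ∉⊥
∈-upTo⁻ {x = suc x} {suc m} (there x∈)  = s≤s (∈-upTo⁻ x∈)

∣upTo∣ : ∀ {n} (m : Fin n) → ∣ upTo m ∣ ≡ suc (toℕ m)
∣upTo∣ {suc n} zero = cong suc (∣⊥∣≡0 n)
∣upTo∣ (suc m)      = cong suc (∣upTo∣ m)

wt-inside : ∀ {n} (S : Subset n) → wt (inside ∷ S) ≡ - wt S
wt-inside S = -1*i≡-i (wt S)

wt-toggle : ∀ {n} (S : Subset n) (v : Fin n) → wt (toggle S v) ≡ - wt S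
wt-toggle (inside  ∷ S) zero    = neg-swap (wt-inside S)
wt-toggle (outside ∷ S) zero    = wt-inside S
wt-toggle (inside  ∷ S) (suc v) = begin
  wt (inside ∷ toggle S v) ≡⟨ wt-inside (toggle S v) ⟩
  - wt (toggle S v)        ≡⟨ cong -_ (wt-toggle S v) ⟩
  - (- wt S)               ≡⟨ cong -_ (sym (wt-inside S)) ⟩
  - wt (inside ∷ S)        ∎
  where open ≡-Reasoning
wt-toggle (outside ∷ S) (suc v) = wt-toggle S v

wt-upTo-suc : ∀ {n} {m m′ : Fin n} → toℕ m ≡ suc (toℕ m′) → wt (upTo m) ≡ - wt (upTo m′)
wt-upTo-suc {m = m} {m′} m≡1+m′ = begin
  -1ℤ ℤ.^ ∣ upTo m ∣               ≡⟨ cong (-1ℤ ℤ.^_) (trans (∣upTo∣ m) (cong suc m≡1+m′)) ⟩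
  -1ℤ ℤ.* -1ℤ ℤ.^ suc (toℕ m′)     ≡⟨ -1*i≡-i _ ⟩
  - (-1ℤ ℤ.^ suc (toℕ m′))         ≡⟨ cong (λ k → - (-1ℤ ℤ.^ k)) (sym (∣upTo∣ m′)) ⟩
  - wt (upTo m′)                   ∎
  where open ≡-Reasoning

prefixSum-zero : ∀ {r} (b : Fin r → ℕ) → prefixSum b 0 ≡ 0
prefixSum-zero {zero}  b = refl
prefixSum-zero {suc r} b = refl

cpos-zero : ∀ {r} (b : Fin (suc r) → ℕ) → cpos b zero ≡ b zero
cpos-zero b = trans (cong (b zero +_) (prefixSum-zero (b ∘ suc))) (+-identityʳ (b zero))

head≤cpos : ∀ {r} (b : Fin (suc r) → ℕ) j → b zero ≤ cpos b j
head≤cpos b zero    = m≤m+n (b zero) _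
head≤cpos b (suc j) = m≤m+n (b zero) _

cpos≤prefixSum : ∀ {r} (b : Fin r → ℕ) j → cpos b j ≤ prefixSum b r
cpos≤prefixSum {suc r} b zero    =
  +-monoʳ-≤ (b zero) (subst (_≤ prefixSum (b ∘ suc) r) (sym (prefixSum-zero (b ∘ suc))) z≤n)
cpos≤prefixSum {suc r} b (suc j) = +-monoʳ-≤ (b zero) (cpos≤prefixSum (b ∘ suc) j)

-- Since r < b_1 + ⋯ + b_r, some part b_j is at least 2.
cpos-gap : ∀ {r} (b : Fin r → ℕ) → (∀ j → 1 ≤ b j) → r < prefixSum b r →
  ∃₂ λ j Q → cpos b j ≡ 2 + Q × (∀ i → cpos b i ≢ suc Q)
cpos-gap {suc r} b b-pos r<Σ = by-head (b zero) refl
  where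
  Goal = ∃₂ λ j Q → cpos b j ≡ 2 + Q × (∀ i → cpos b i ≢ suc Q)
  by-head : ∀ c → b zero ≡ c → Goal
  by-head zero          b₀≡ = contradiction (subst (1 ≤_) b₀≡ (b-pos zero)) λ ()
  by-head (suc (suc Q)) b₀≡ = zero , Q , trans (cpos-zero b) b₀≡ , λ i e →
    1+n≰n (≤-trans (≤-reflexive (sym b₀≡)) (≤-trans (head≤cpos b i) (≤-reflexive e)))
  by-head (suc zero)    b₀≡
    with j , Q , cⱼ≡ , gap ← cpos-gap (b ∘ suc) (b-pos ∘ suc)
           (s≤s⁻¹ (subst (suc r <_) (cong (_+ prefixSum (b ∘ suc) r) b₀≡) r<Σ))
    = suc j , suc Q , trans (cong (_+ cpos (b ∘ suc) j) b₀≡) (cong suc cⱼ≡) , gap′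
    where
    gap′ : ∀ i → cpos b i ≢ 2 + Q
    gap′ zero    e = 0≢1+n (suc-injective (trans (sym (trans (cpos-zero b) b₀≡)) e))
    gap′ (suc i) e = gap i (suc-injective (trans (sym (cong (_+ cpos (b ∘ suc) i) b₀≡)) e))

-- Chosen preimages of 0, …, m are distinct, and a collision provides one more index.
cover-collision⇒< : ∀ {n m} (f : Fin n → ℕ) → (∀ v → v ≤ m → ∃ λ k → f k ≡ v) →
  ∀ {a c} → a ≢ c → f a ≡ f c → suc m < n
cover-collision⇒< {n} {m} f cover {a} {c} a≢c fa≡fc = injective⇒≤ t-injective
  where
  s : Fin (suc m) → Fin n
  s i = proj₁ (cover (toℕ i) (toℕ≤pred[n] i))

  f∘s : ∀ i → f (s i) ≡ toℕ i
  f∘s i = proj₂ (cover (toℕ i) (toℕ≤pred[n] i))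

  s-reflects : ∀ {i j} → f (s i) ≡ f (s j) → i ≡ j
  s-reflects {i} {j} e = toℕ-injective (trans (sym (f∘s i)) (trans e (f∘s j)))

  fresh : ∃ λ x → ∀ i → s i ≢ x
  fresh with any? (λ i → s i F.≟ a)
  ... | no a∉s          = a , λ i sᵢ≡a → a∉s (i , sᵢ≡a)
  ... | yes (i , sᵢ≡a) = c , λ j sⱼ≡c →
    a≢c (trans (sym sᵢ≡a) (trans (cong s (s-reflects (trans (cong f sᵢ≡a) (trans fa≡fc (cong f (sym sⱼ≡c)))))) sⱼ≡c))

  t : Fin (suc (suc m)) → Fin n
  t zero    = proj₁ fresh
  t (suc i) = s i

  t-injective : ∀ {i j} → t i ≡ t j → i ≡ j
  t-injective {zero}  {zero}  _ = refl
  t-injective {zero}  {suc j} e = contradiction (sym e) (proj₂ fresh j)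
  t-injective {suc i} {zero}  e = contradiction e (proj₂ fresh i)
  t-injective {suc i} {suc j} e = cong suc (s-reflects (cong f e))

Separates : ∀ {n} → (Fin n → ℕ) → Fin n → Set
Separates f q = (∀ k → k F.< q → f k ≤ f q) × (∀ k → q F.< k → f q < f k)

record Packed {n} (End : Fin (suc n) → Set) (f : Fin (suc n) → ℕ) : Set where
  field
    peak      : ∀ q → f q ≤ f (fromℕ n)
    covers    : ∀ v → v ≤ f (fromℕ n) → ∃ λ k → f k ≡ v
    separates : ∀ q → End q → Separates f q

Packed-resp : ∀ {n End} {f g : Fin (suc n) → ℕ} → f ≗ g → Packed End f → Packed End g
Packed-resp {n} {f = f} {g} f≗g P = record
  { peak      = λ q → subst₂ _≤_ (f≗g q) (f≗g (fromℕ n)) (peak q)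
  ; covers    = λ v v≤ → let k , fk≡v = covers v (subst (v ≤_) (sym (f≗g (fromℕ n))) v≤)
                         in k , trans (sym (f≗g k)) fk≡v
  ; separates = λ q e → (λ k k<q → subst₂ _≤_ (f≗g k) (f≗g q) (proj₁ (separates q e) k k<q))
                      , (λ k q<k → subst₂ _<_ (f≗g q) (f≗g k) (proj₂ (separates q e) k q<k))
  }
  where open Packed P

collapse : ℕ → ℕ → ℕ
collapse M v with v <? M
... | yes _ = v
... | no  _ = pred v

collapse-< : ∀ {M v} → v < M → collapse M v ≡ v
collapse-< {M} {v} v<M with v <? M
... | yes _   = refl
... | no  v≮M = contradiction v<M v≮M

collapse-≥ : ∀ {M v} → M ≤ v → collapse M v ≡ pred v
collapse-≥ {M} {v} M≤v with v <? M
... | yes v<M = contradiction M≤v (<⇒≱ v<M)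
... | no  _   = refl

collapse-≤ : ∀ M v → collapse M v ≤ v
collapse-≤ M v with v <? M
... | yes _ = ≤-refl
... | no  _ = pred[n]≤n

collapse-mono-≤ : ∀ M {v w} → v ≤ w → collapse M v ≤ collapse M w
collapse-mono-≤ M {v} {w} v≤w with v <? M | w <? M
... | yes _   | yes _   = v≤w
... | yes v<M | no  w≮M = <⇒≤pred (<-≤-trans v<M (≮⇒≥ w≮M))
... | no  v≮M | yes w<M = contradiction (≤-<-trans v≤w w<M) v≮M
... | no  _   | no  _   = pred-mono-≤ v≤w

collapse-mono-< : ∀ {M v w} → 1 ≤ M → v < w → (w ≡ M → suc v < M) → collapse M v < collapse M w
collapse-mono-< {M} {v} {w} 1≤M v<w edge with v <? M | w <? M
... | yes _   | yes _   = v<w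
... | yes v<M | no  w≮M = <⇒≤pred 1+v<w
  where
  1+v<w : suc v < w
  1+v<w with w ≟ M
  ... | yes w≡M = subst (suc v <_) (sym w≡M) (edge w≡M)
  ... | no  w≢M = <-≤-trans (s≤s v<M) (≤∧≢⇒< (≮⇒≥ w≮M) (w≢M ∘ sym))
... | no  v≮M | yes w<M = contradiction (<-trans v<w w<M) v≮M
... | no  v≮M | no  _   = pred-mono-< ⦃ >-nonZero (≤-trans 1≤M (≮⇒≥ v≮M)) ⦄ v<w

module Reshape {n} (End : Fin (suc n) → Set) {p p⁻ : Fin (suc n)}
  (p⁻+1≡p : suc (toℕ p⁻) ≡ toℕ p) (end-p : End p) (¬end-p⁻ : ¬ End p⁻) where

  last : Fin (suc n)
  last = fromℕ n

  Collides : (Fin (suc n) → ℕ) → Set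
  Collides f = ∃ λ k → k ≢ p × f k ≡ f p

  collides? : ∀ f → Dec (Collides f)
  collides? f = any? (λ k → ¬? (k F.≟ p) ×-dec (f k ≟ f p))

  Collides-resp : ∀ {f g} → f ≗ g → Collides f → Collides g
  Collides-resp f≗g (k , k≢p , fk≡fp) = k , k≢p , trans (sym (f≗g k)) (trans fk≡fp (f≗g p))

  merge : (Fin (suc n) → ℕ) → Fin (suc n) → ℕ
  merge f k = collapse (f p) (f k)

  merge-cong : ∀ {f g} → f ≗ g → merge f ≗ merge g
  merge-cong f≗g k = cong₂ collapse (f≗g p) (f≗g k)

  -- split gets the decision k ≟ p only as a Bool, so that it respects ≗.
  raise : Bool → ℕ → ℕ → ℕ
  raise true  M v = suc v
  raise false M v with M <? v
  ... | yes _ = suc v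
  ... | no  _ = v

  split : (Fin (suc n) → ℕ) → Fin (suc n) → ℕ
  split f k = raise (does (k F.≟ p)) (f p) (f k)

  split-cong : ∀ {f g} → f ≗ g → split f ≗ split g
  split-cong f≗g k = cong₂ (raise (does (k F.≟ p))) (f≗g p) (f≗g k)

  data Lifted (f : Fin (suc n) → ℕ) (k : Fin (suc n)) : Set where
    at-p  : k ≡ p → Lifted f k
    above : f p < f k → Lifted f k

  lifted? : ∀ f k → Dec (Lifted f k)
  lifted? f k with k F.≟ p | f p <? f k
  ... | yes k≡p | _         = yes (at-p k≡p)
  ... | no  _   | yes fp<fk = yes (above fp<fk)
  ... | no  k≢p | no  fp≮fk = no λ { (at-p k≡p) → k≢p k≡p ; (above fp<fk) → fp≮fk fp<fk }

  split-lifted : ∀ f {k} → Lifted f k → split f k ≡ suc (f k)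
  split-lifted f {k} l with k F.≟ p
  ... | yes _ = refl
  ... | no k≢p with f p <? f k
  ...   | yes _    = refl
  ...   | no  fp≮fk = contradiction l λ { (at-p k≡p) → k≢p k≡p ; (above fp<fk) → fp≮fk fp<fk }

  split-unlifted : ∀ f {k} → ¬ Lifted f k → split f k ≡ f k
  split-unlifted f {k} ¬l with k F.≟ p
  ... | yes k≡p = contradiction (at-p k≡p) ¬l
  ... | no  _ with f p <? f k
  ...   | yes fp<fk = contradiction (above fp<fk) ¬l
  ...   | no  _     = refl

  split-fixed : ∀ f {k} → k ≢ p → f k ≤ f p → split f k ≡ f k
  split-fixed f k≢p fk≤fp = split-unlifted f λ { (at-p k≡p) → k≢p k≡p ; (above fp<fk) → <⇒≱ fp<fk fk≤fp }

  split-p : ∀ f → split f p ≡ suc (f p)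
  split-p f = split-lifted f (at-p refl)

  lifted⇒≥ : ∀ {f k} → Lifted f k → f p ≤ f k
  lifted⇒≥ (at-p refl)   = ≤-refl
  lifted⇒≥ (above fp<fk) = <⇒≤ fp<fk

  merge∘split : ∀ f → merge (split f) ≗ f
  merge∘split f k rewrite split-p f with lifted? f k
  ... | yes l  = trans (cong (collapse (suc (f p))) (split-lifted f l)) (collapse-≥ (s≤s (lifted⇒≥ l)))
  ... | no  ¬l = trans (cong (collapse (suc (f p))) (split-unlifted f ¬l)) (collapse-< (s≤s (≮⇒≥ (¬l ∘ above))))

  split-¬collides : ∀ f → ¬ Collides (split f)
  split-¬collides f (k , k≢p , e) with lifted? f k
  ... | yes (at-p k≡p)   = k≢p k≡p
  ... | yes (above fp<fk) = <-irrefl (sym (suc-injective (trans (sym (split-lifted f (above fp<fk))) (trans e (split-p f))))) fp<fk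
  ... | no  ¬l            = ¬l (above (≤-reflexive (trans (sym (split-p f)) (trans (sym e) (split-unlifted f ¬l)))))

  module _ {f} (P : Packed End f) where
    open Packed P

    after-p : ∀ k → p F.< k → f p < f k
    after-p = proj₂ (separates p end-p)

    -- Everything after p is above f p, so being lifted propagates to the right and upwards.
    lifted-upward : ∀ {k l} → Lifted f k → k F.≤ l → f k ≤ f l → Lifted f l
    lifted-upward {l = l} (at-p refl) p≤l _ with l F.≟ p
    ... | yes l≡p = at-p l≡p
    ... | no  l≢p = above (after-p l (≤∧≢⇒< p≤l (l≢p ∘ sym ∘ toℕ-injective)))
    lifted-upward (above fp<fk) _ fk≤fl = above (<-≤-trans fp<fk fk≤fl)

    split-mono-≤ : ∀ {k l} → k F.≤ l → f k ≤ f l → split f k ≤ split f l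
    split-mono-≤ {k} {l} k≤l fk≤fl with lifted? f k | lifted? f l
    ... | yes lk  | yes ll  rewrite split-lifted f lk    | split-lifted f ll    = s≤s fk≤fl
    ... | yes lk  | no  ¬ll = contradiction (lifted-upward lk k≤l fk≤fl) ¬ll
    ... | no  ¬lk | yes ll  rewrite split-unlifted f ¬lk | split-lifted f ll    = m≤n⇒m≤1+n fk≤fl
    ... | no  ¬lk | no  ¬ll rewrite split-unlifted f ¬lk | split-unlifted f ¬ll = fk≤fl

    split-mono-< : ∀ {k l} → k F.≤ l → f k < f l → split f k < split f l
    split-mono-< {k} {l} k≤l fk<fl with lifted? f k | lifted? f l
    ... | yes lk  | yes ll  rewrite split-lifted f lk    | split-lifted f ll    = s≤s fk<fl
    ... | yes lk  | no  ¬ll = contradiction (lifted-upward lk k≤l (<⇒≤ fk<fl)) ¬ll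
    ... | no  ¬lk | yes ll  rewrite split-unlifted f ¬lk | split-lifted f ll    = m<n⇒m<1+n fk<fl
    ... | no  ¬lk | no  ¬ll rewrite split-unlifted f ¬lk | split-unlifted f ¬ll = fk<fl

    split-last : split f last ≡ suc (f last)
    split-last = split-lifted f (lifted-upward (at-p refl) (≤fromℕ p) (peak p))

    module _ (c : Collides f) where

      split-covers : ∀ v → v ≤ split f last → ∃ λ k → split f k ≡ v
      split-covers v v≤ with <-cmp v (f p)
      ... | tri< v<fp _ _ = let k , fk≡v = covers v (≤-trans (<⇒≤ v<fp) (peak p)) in
        k , trans (split-fixed f (k≢p fk≡v) (≤-trans (≤-reflexive fk≡v) (<⇒≤ v<fp))) fk≡v
        where
        k≢p : ∀ {k} → f k ≡ v → k ≢ p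
        k≢p fk≡v refl = <-irrefl (sym fk≡v) v<fp
      ... | tri≈ _ v≡fp _ = let k₀ , k₀≢p , fk₀≡fp = c in
        k₀ , trans (split-fixed f k₀≢p (≤-reflexive fk₀≡fp)) (trans fk₀≡fp (sym v≡fp))
      split-covers (suc w) 1+w≤ | tri> _ _ (s≤s fp≤w) with m≤n⇒m<n∨m≡n fp≤w
      ... | inj₂ fp≡w = p , trans (split-p f) (cong suc fp≡w)
      ... | inj₁ fp<w = let k , fk≡w = covers w (s≤s⁻¹ (subst (suc w ≤_) split-last 1+w≤)) in
        k , trans (split-lifted f (above (subst (f p <_) (sym fk≡w) fp<w))) (cong suc fk≡w)

      split-packed : Packed End (split f)
      split-packed = record
        { peak      = λ q → split-mono-≤ (≤fromℕ q) (peak q)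
        ; covers    = split-covers
        ; separates = λ q e → (λ k k<q → split-mono-≤ (<⇒≤ k<q) (proj₁ (separates q e) k k<q))
                            , (λ k q<k → split-mono-< (<⇒≤ q<k) (proj₂ (separates q e) k q<k))
        }

    module _ (¬c : ¬ Collides f) where

      ≡fp⇒≡p : ∀ {k} → f k ≡ f p → k ≡ p
      ≡fp⇒≡p {k} fk≡fp with k F.≟ p
      ... | yes k≡p = k≡p
      ... | no  k≢p = contradiction (k , k≢p , fk≡fp) ¬c

      fp⁻<fp : f p⁻ < f p
      fp⁻<fp = ≤∧≢⇒< (proj₁ (separates p end-p) p⁻ (≤-reflexive p⁻+1≡p)) λ fp⁻≡fp →
        1+n≢n (trans p⁻+1≡p (cong toℕ (sym (≡fp⇒≡p fp⁻≡fp))))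

      1≤fp : 1 ≤ f p
      1≤fp = ≤-trans (s≤s z≤n) fp⁻<fp

      -- The critical case f k = f p forces k = p, and then f q < f p⁻ < f p leaves room.
      merge-mono-< : ∀ q → End q → ∀ k → q F.< k → f q < f k → merge f q < merge f k
      merge-mono-< q end-q k q<k fq<fk = collapse-mono-< 1≤fp fq<fk λ fk≡fp →
        ≤-trans (s≤s (proj₂ (separates q end-q) p⁻ (q<p⁻ (subst (q F.<_) (≡fp⇒≡p fk≡fp) q<k)))) fp⁻<fp
        where
        q<p⁻ : q F.< p → q F.< p⁻
        q<p⁻ q<p = ≤∧≢⇒< (s≤s⁻¹ (subst (toℕ q <_) (sym p⁻+1≡p) q<p))
                         λ q≡p⁻ → ¬end-p⁻ (subst End (toℕ-injective q≡p⁻) end-q)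

      merge-last : suc (merge f last) ≡ f last
      merge-last = trans (cong suc (collapse-≥ (peak p))) (suc-pred (f last) ⦃ >-nonZero (≤-trans 1≤fp (peak p)) ⦄)

      merge-covers : ∀ v → v ≤ merge f last → ∃ λ k → merge f k ≡ v
      merge-covers v v≤ with v <? f p
      ... | yes v<fp = let k , fk≡v = covers v (≤-trans v≤ (collapse-≤ (f p) (f last))) in
        k , trans (cong (collapse (f p)) fk≡v) (collapse-< v<fp)
      ... | no  v≮fp = let k , fk≡1+v = covers (suc v) (subst (suc v ≤_) merge-last (s≤s v≤)) in
        k , trans (cong (collapse (f p)) fk≡1+v) (collapse-≥ (m≤n⇒m≤1+n (≮⇒≥ v≮fp)))

      merge-packed : Packed End (merge f)
      merge-packed = record
        { peak      = λ q → collapse-mono-≤ (f p) (peak q)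
        ; covers    = merge-covers
        ; separates = λ q e → (λ k k<q → collapse-mono-≤ (f p) (proj₁ (separates q e) k k<q))
                            , (λ k q<k → merge-mono-< q e k q<k (proj₂ (separates q e) k q<k))
        }

      suc-pred-fp : suc (pred (f p)) ≡ f p
      suc-pred-fp = suc-pred (f p) ⦃ >-nonZero 1≤fp ⦄

      merge-p : suc (merge f p) ≡ f p
      merge-p = trans (cong suc (collapse-≥ {f p} ≤-refl)) suc-pred-fp

      merge-collides : Collides (merge f)
      merge-collides with k , fk≡pred ← covers (pred (f p)) (≤-trans pred[n]≤n (peak p)) =
        k , k≢p , trans (cong (collapse (f p)) fk≡pred) (trans (collapse-< pred<fp) (sym (collapse-≥ {f p} ≤-refl)))
        where
        pred<fp : pred (f p) < f p
        pred<fp = ≤-reflexive suc-pred-fp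
        k≢p : k ≢ p
        k≢p k≡p = <-irrefl (trans (sym fk≡pred) (cong f k≡p)) pred<fp

      split∘merge : split (merge f) ≗ f
      split∘merge k with <-cmp (f k) (f p)
      ... | tri≈ _ fk≡fp _ rewrite ≡fp⇒≡p fk≡fp = trans (split-p (merge f)) merge-p
      ... | tri< fk<fp _ _ = trans (split-fixed (merge f) (λ k≡p → <-irrefl (cong f k≡p) fk<fp)
                                      (collapse-mono-≤ (f p) (<⇒≤ fk<fp)))
                                   (collapse-< fk<fp)
      ... | tri> _ _ fp<fk = begin
        split (merge f) k ≡⟨ split-lifted (merge f) (above (collapse-mono-< 1≤fp fp<fk λ fk≡fp → contradiction (sym fk≡fp) (<⇒≢ fp<fk))) ⟩
        suc (merge f k)   ≡⟨ cong suc (collapse-≥ (<⇒≤ fp<fk)) ⟩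
        suc (pred (f k))  ≡⟨ suc-pred (f k) ⦃ >-nonZero (≤-trans 1≤fp (<⇒≤ fp<fk)) ⦄ ⟩
        f k               ∎
        where open ≡-Reasoning

clamp : ∀ {n} → ℕ → Fin (suc n)
clamp {n} v = fromℕ< (s≤s (m⊓n≤n v n))

toℕ-clamp : ∀ {n v} → v ≤ n → toℕ (clamp {n} v) ≡ v
toℕ-clamp v≤n = trans (toℕ-fromℕ< _) (m≤n⇒m⊓n≡m v≤n)

module Involution {n r} (b : Fin r → ℕ) {p p⁻ : Fin (suc n)} (p⁻+1≡p : suc (toℕ p⁻) ≡ toℕ p)
  {jₚ : Fin r} (end-p : toℕ p + 1 ≡ cpos b jₚ) (¬end-p⁻ : ∀ j → toℕ p⁻ + 1 ≢ cpos b j) where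

  End : Fin (suc n) → Set
  End q = ∃ λ j → toℕ q + 1 ≡ cpos b j

  open Reshape End p⁻+1≡p (jₚ , end-p) (uncurry ¬end-p⁻)

  Labelling : Set
  Labelling = Vec (Fin (suc n)) (suc n)

  Pair : Set
  Pair = Subset (suc n) × Labelling

  values : Labelling → Fin (suc n) → ℕ
  values θ = toℕ ∘ lookup θ

  values≤n : ∀ θ k → values θ k ≤ n
  values≤n θ k = toℕ≤pred[n] (lookup θ k)

  relabel : (Fin (suc n) → ℕ) → Labelling
  relabel h = tabulate (clamp ∘ h)

  values-relabel : ∀ {h} → (∀ k → h k ≤ n) → values (relabel h) ≗ h
  values-relabel {h} h≤n k = trans (cong toℕ (lookup∘tabulate (clamp ∘ h) k)) (toℕ-clamp (h≤n k))

  relabel-values : ∀ {h θ} → h ≗ values θ → relabel h ≡ θ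
  relabel-values {h} {θ} h≗θ = trans (tabulate-cong λ k → toℕ-injective
    (trans (toℕ-clamp (subst (_≤ n) (sym (h≗θ k)) (values≤n θ k))) (h≗θ k))) (tabulate∘lookup θ)

  Free : Labelling → Fin (suc n) → Set
  Free θ v = v F.< lookup θ last × ¬ (∃ λ k → lookup θ k ≡ v)

  free? : ∀ θ → Dec (∃ (Free θ))
  free? θ = any? λ v → (v F.<? lookup θ last) ×-dec ¬? (any? λ k → lookup θ k F.≟ v)

  packed : Labelling → Pair
  packed θ = upTo (lookup θ last) , θ

  reshape : ∀ θ → Dec (Collides (values θ)) → Pair
  reshape θ (yes _) = packed (relabel (split (values θ)))
  reshape θ (no  _) = packed (relabel (merge (values θ)))

  step : Subset (suc n) → ∀ θ → Dec (∃ (Free θ)) → Pair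
  step S θ (yes (v , _)) = toggle S v , θ
  step S θ (no  _)       = reshape θ (collides? (values θ))

  φ : Pair → Pair
  φ (S , θ) = step S θ (free? θ)

  last+1 : toℕ last + 1 ≡ suc n
  last+1 = trans (+-comm (toℕ last) 1) (cong suc (toℕ-fromℕ n))

  +1≡⇒last : ∀ {q} → toℕ q + 1 ≡ suc n → q ≡ last
  +1≡⇒last {q} e = toℕ-injective (trans (suc-injective (trans (+-comm 1 (toℕ q)) e)) (sym (toℕ-fromℕ n)))

  inC-max : ∀ S θ → InC b S θ → ∀ x → x ∈ S → x F.≤ lookup θ last
  inC-max _ _ (_ , _ , max , _) = proj₂ (max last last+1)

  ¬free⇒covers : ∀ θ → ¬ ∃ (Free θ) → ∀ v → v ≤ values θ last → ∃ λ k → values θ k ≡ v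
  ¬free⇒covers θ ¬free v v≤ with m≤n⇒m<n∨m≡n v≤ | any? (λ k → lookup θ k F.≟ clamp v)
  ... | inj₂ v≡ | _              = last , sym v≡
  ... | inj₁ _  | yes (k , θk≡v) = k , trans (cong toℕ θk≡v) (toℕ-clamp (≤-trans v≤ (values≤n θ last)))
  ... | inj₁ v< | no  v∉         = contradiction (clamp v , clamp-v<last , v∉) ¬free
    where
    clamp-v<last : clamp v F.< lookup θ last
    clamp-v<last = subst (_< values θ last) (sym (toℕ-clamp (≤-trans v≤ (values≤n θ last)))) v<

  inC⇒packed : ∀ S θ → InC b S θ → ¬ ∃ (Free θ) → Packed End (values θ)
  inC⇒packed S θ x∈C@(_ , θ∈S , _ , sep) ¬free = record
    { peak      = λ q → inC-max S θ x∈C (lookup θ q) (θ∈S q)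
    ; covers    = ¬free⇒covers θ ¬free
    ; separates = λ { q (j , e) → sep j q e }
    }

  inC⇒upTo : ∀ S θ → InC b S θ → ¬ ∃ (Free θ) → S ≡ upTo (lookup θ last)
  inC⇒upTo S θ x∈C@(_ , θ∈S , _ , _) ¬free = ⊆-antisym
    (λ {x} x∈S → ∈-upTo⁺ (inC-max S θ x∈C x x∈S))
    (λ {x} x∈↓ → let k , θk≡x = ¬free⇒covers θ ¬free (toℕ x) (∈-upTo⁻ x∈↓) in
                 subst (_∈ S) (toℕ-injective θk≡x) (θ∈S k))

  packed⇒inC : ∀ θ → Packed End (values θ) → InC b (upTo (lookup θ last)) θ
  packed⇒inC θ P = (lookup θ last , ∈-upTo⁺ ≤-refl) , (λ q → ∈-upTo⁺ (peak q)) , is-max , λ j q e → separates q (j , e)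
    where
    open Packed P
    is-max : ∀ q → toℕ q + 1 ≡ suc n → IsMax (upTo (lookup θ last)) (lookup θ q)
    is-max q e rewrite +1≡⇒last e = ∈-upTo⁺ ≤-refl , λ x → ∈-upTo⁻

  packed⇒¬free : ∀ θ → Packed End (values θ) → ¬ ∃ (Free θ)
  packed⇒¬free θ P (v , v<last , v∉) = let k , θk≡v = Packed.covers P (toℕ v) (<⇒≤ v<last) in
    v∉ (k , toℕ-injective θk≡v)

  inC-toggle : ∀ S θ {v} → InC b S θ → Free θ v → InC b (toggle S v) θ
  inC-toggle S θ {v} (_ , θ∈S , max , sep) (v<last , v∉) = (lookup θ last , θ∈S′ last) , θ∈S′ , is-max , sep
    where
    θ∈S′ : ∀ q → lookup θ q ∈ toggle S v
    θ∈S′ q = ∈-toggle⁺ (λ θq≡v → v∉ (q , θq≡v)) (θ∈S q)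
    below : ∀ x → x ∈ toggle S v → x F.≤ lookup θ last
    below x x∈ with x F.≟ v
    ... | yes refl = <⇒≤ v<last
    ... | no  x≢v  = proj₂ (max last last+1) x (∈-toggle⁻ x≢v x∈)
    is-max : ∀ q → toℕ q + 1 ≡ suc n → IsMax (toggle S v) (lookup θ q)
    is-max q e rewrite +1≡⇒last e = θ∈S′ last , below

  Partner : Pair → Pair → Set
  Partner x y = InC b (proj₁ y) (proj₂ y) × φ y ≡ x × wt (proj₁ x) ≡ - wt (proj₁ y)

  φ-packed : ∀ θ → Packed End (values θ) → φ (packed θ) ≡ reshape θ (collides? (values θ))
  φ-packed θ P with free? θ
  ... | yes free = contradiction free (packed⇒¬free θ P)
  ... | no  _    = refl

  reshape-collides : ∀ {θ} (d : Dec (Collides (values θ))) → Collides (values θ) →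
    reshape θ d ≡ packed (relabel (split (values θ)))
  reshape-collides (yes _) _ = refl
  reshape-collides (no ¬c) c = contradiction c ¬c

  reshape-¬collides : ∀ {θ} (d : Dec (Collides (values θ))) → ¬ Collides (values θ) →
    reshape θ d ≡ packed (relabel (merge (values θ)))
  reshape-¬collides (yes c) ¬c = contradiction c ¬c
  reshape-¬collides (no _)  _  = refl

  split-partner : ∀ {θ} → Packed End (values θ) → Collides (values θ) →
    Partner (packed θ) (packed (relabel (split (values θ))))
  split-partner {θ} P c@(k₀ , k₀≢p , fk₀≡fp) = packed⇒inC θ′ P′ , inverse , weight
    where
    f = values θ
    θ′ = relabel (split f)

    -- A collision means f misses a value of Fin (suc n), so f last + 1 still fits.
    f-last<n : f last < n
    f-last<n = s≤s⁻¹ (cover-collision⇒< f (Packed.covers P) k₀≢p fk₀≡fp)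

    θ′≗ : values θ′ ≗ split f
    θ′≗ = values-relabel λ k →
      ≤-trans (split-mono-≤ P (≤fromℕ k) (Packed.peak P k)) (≤-trans (≤-reflexive (split-last P)) f-last<n)

    P′ : Packed End (values θ′)
    P′ = Packed-resp (sym ∘ θ′≗) (split-packed P c)

    inverse : φ (packed θ′) ≡ packed θ
    inverse = begin
      φ (packed θ′)                        ≡⟨ φ-packed θ′ P′ ⟩
      reshape θ′ (collides? (values θ′))   ≡⟨ reshape-¬collides _ (split-¬collides f ∘ Collides-resp θ′≗) ⟩
      packed (relabel (merge (values θ′))) ≡⟨ cong packed (relabel-values λ k → trans (merge-cong θ′≗ k) (merge∘split f k)) ⟩
      packed θ                             ∎
      where open ≡-Reasoning

    weight : wt (upTo (lookup θ last)) ≡ - wt (upTo (lookup θ′ last))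
    weight = neg-swap (wt-upTo-suc (trans (θ′≗ last) (split-last P)))

  merge-partner : ∀ {θ} → Packed End (values θ) → ¬ Collides (values θ) →
    Partner (packed θ) (packed (relabel (merge (values θ))))
  merge-partner {θ} P ¬c = packed⇒inC θ′ P′ , inverse , weight
    where
    f = values θ
    θ′ = relabel (merge f)

    θ′≗ : values θ′ ≗ merge f
    θ′≗ = values-relabel λ k → ≤-trans (collapse-≤ (f p) (f k)) (values≤n θ k)

    P′ : Packed End (values θ′)
    P′ = Packed-resp (sym ∘ θ′≗) (merge-packed P ¬c)

    inverse : φ (packed θ′) ≡ packed θ
    inverse = begin
      φ (packed θ′)                        ≡⟨ φ-packed θ′ P′ ⟩
      reshape θ′ (collides? (values θ′))   ≡⟨ reshape-collides _ (Collides-resp (sym ∘ θ′≗) (merge-collides P ¬c)) ⟩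
      packed (relabel (split (values θ′))) ≡⟨ cong packed (relabel-values λ k → trans (split-cong θ′≗ k) (split∘merge P ¬c k)) ⟩
      packed θ                             ∎
      where open ≡-Reasoning

    weight : wt (upTo (lookup θ last)) ≡ - wt (upTo (lookup θ′ last))
    weight = wt-upTo-suc (trans (sym (merge-last P ¬c)) (cong suc (sym (θ′≗ last))))

  φ-involution : ∀ x → InC b (proj₁ x) (proj₂ x) → Partner x (φ x)
  φ-involution (S , θ) x∈C with free? θ in free≡
  ... | yes (v , v-free) = inC-toggle S θ x∈C v-free , toggle-back , neg-swap (wt-toggle S v)
    where
    toggle-back : step (toggle S v) θ (free? θ) ≡ (S , θ)
    toggle-back rewrite free≡ = cong (_, θ) (toggle-involutive S v)
  ... | no ¬free rewrite inC⇒upTo S θ x∈C ¬free with collides? (values θ)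
  ...   | yes c  = split-partner (inC⇒packed S θ x∈C ¬free) c
  ...   | no  ¬c = merge-partner (inC⇒packed S θ x∈C ¬free) ¬c

lemma4 : (n r : ℕ) → 0 < r → r < n →
    (b : Fin r → ℕ) → (∀ j → 1 ≤ b j) → prefixSum b r ≡ n →
    Σ (Subset n × Vec (Fin n) n → Subset n × Vec (Fin n) n) λ φ →
      ∀ x → InC b (proj₁ x) (proj₂ x) →
        InC b (proj₁ (φ x)) (proj₂ (φ x))
        × φ (φ x) ≡ x
        × wt (proj₁ x) ≡ - wt (proj₁ (φ x))
lemma4 zero    r _ () b b-pos Σb≡n
lemma4 (suc n) r _ r<n b b-pos Σb≡n
  with j , Q , cⱼ≡2+Q , gap ← cpos-gap b b-pos (subst (r <_) (sym Σb≡n) r<n)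
  = Involution.φ b p⁻+1≡p end-p ¬end-p⁻ , Involution.φ-involution b p⁻+1≡p end-p ¬end-p⁻
  where
  2+Q≤1+n : 2 + Q ≤ suc n
  2+Q≤1+n = subst₂ _≤_ cⱼ≡2+Q Σb≡n (cpos≤prefixSum b j)

  p p⁻ : Fin (suc n)
  p  = fromℕ< 2+Q≤1+n
  p⁻ = fromℕ< (<⇒≤ 2+Q≤1+n)

  p⁻+1≡p : suc (toℕ p⁻) ≡ toℕ p
  p⁻+1≡p = trans (cong suc (toℕ-fromℕ< (<⇒≤ 2+Q≤1+n))) (sym (toℕ-fromℕ< 2+Q≤1+n))

  end-p : toℕ p + 1 ≡ cpos b j
  end-p = trans (cong (_+ 1) (toℕ-fromℕ< 2+Q≤1+n)) (trans (+-comm (suc Q) 1) (sym cⱼ≡2+Q))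

  ¬end-p⁻ : ∀ i → toℕ p⁻ + 1 ≢ cpos b i
  ¬end-p⁻ i e = gap i (trans (sym e) (trans (cong (_+ 1) (toℕ-fromℕ< (<⇒≤ 2+Q≤1+n))) (+-comm Q 1)))
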